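{- For all integers $a,b\geq 1$ (and a large enough ground set), $f(a,b)\geq \binom{a+b}{a}-1$.
   Context: For integers $a,b\ge 1$, $f(a,b)$ denotes the maximum $m$ such that there exist sets $A_1,\dots,A_m$, each of size $a$, and sets $B_1,\dots,B_m$, each of size $b$ (subsets of a sufficiently large finite ground set $[k]$), with $A_i\cap B_j\neq\emptyset$ if and only if $i\geq j$. -}

module Defs where

open import Data.Nat using (ℕ; _≤_)
open import Data.Fin using (Fin; toℕ)
open import Data.Fin.Subset using (Subset; _∩_; ∣_∣; Nonempty)
open import Data.Product using (Σ; ∃; _×_)
open import Relation.Binary.PropositionalEquality using (_≡_)
open import Function.Bundles using (_⇔_)

-- A valid (a,b)-system of m pairs over the ground set Fin k:
-- sets A_1..A_m of size a, B_1..B_m of size b, with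
-- A_i ∩ B_j ≠ ∅  iff  i ≥ j.   (indices 0-based: Fin m)
record IsSystem (a b m k : ℕ) (A B : Fin m → Subset k) : Set where
  field
    sizeA : ∀ i → ∣ A i ∣ ≡ a
    sizeB : ∀ j → ∣ B j ∣ ≡ b
    cross : ∀ i j → Nonempty (A i ∩ B j) ⇔ (toℕ j ≤ toℕ i)

-- "f(a,b) ≥ m": some such system with m pairs exists over some finite ground set.
AchievesAtLeast : ℕ → ℕ → ℕ → Set
AchievesAtLeast a b m =
  Σ ℕ λ k → Σ (Fin m → Subset k) λ A → Σ (Fin m → Subset k) λ B → IsSystem a b m k A B

-- A system for (a + 1, b + 1) is glued from a system S for (a + 1, b) and a system T for
-- (a, b + 1) around a new point x. Adding x to every A-set of T and putting in front of them
-- the pair (x ∪ P, x ∪ Q), with P and Q fresh of sizes a and b, gives |T| + 1 pairs whose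
-- A-sets all contain x. Then S goes first, with x added to each of its B-sets: every later
-- A-set meets these B-sets at x, while the A-sets of S avoid all later B-sets. Hence
-- f(a + 1, b + 1) ≥ f(a + 1, b) + 1 + f(a, b + 1), which is Pascal's rule for C(a + b, a) − 1.
-- The recursion bottoms out at the empty system, so the bound holds even if a or b is 0.
module Submission where

open import Defs
open import Data.Nat using (ℕ; zero; suc; _+_; _∸_; _≤_; _<_; z≤n; s≤s; s≤s⁻¹)
open import Data.Nat.Properties using (+-comm; +-suc; +-identityʳ; ≤-trans; <⇒≤; <⇒≱; m≤m+n; +-monoʳ-≤; +-cancelˡ-≤)
open import Data.Nat.Combinatorics using (_C_; nCn≡1; nCk+nC[k+1]≡[n+1]C[k+1])
open import Data.Bool using (true; false)
open import Data.Empty using (⊥-elim)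
open import Data.Sum using (_⊎_; inj₁; inj₂; [_,_])
open import Data.Product using (Σ; ∃-syntax; _×_; _,_)
open import Data.Fin using (Fin; toℕ; splitAt; join; _↑ˡ_; _↑ʳ_) renaming (zero to fzero; suc to fsuc)
open import Data.Fin.Properties using (toℕ<n; toℕ-↑ˡ; toℕ-↑ʳ; join-splitAt)
open import Data.Fin.Subset using (Subset; _∩_; ∣_∣; Nonempty; Empty; _∈_; ⊥; ⊤; ⁅_⁆)
open import Data.Fin.Subset.Properties using (∉⊥; ∣⊥∣≡0; ∣⊤∣≡n; x∈⁅x⁆; x∈p∩q⁺; ∩-zeroˡ; ∩-zeroʳ)
open import Data.Vec using (_∷_; []; _++_; here; there)
open import Function using (_∘_; id)
open import Function.Bundles using (_⇔_; mk⇔; Equivalence)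
open import Function.Construct.Composition using (_⇔-∘_)
open import Function.Related.Propositional using (module EquationalReasoning)
open import Relation.Nullary using (¬_)
open import Relation.Binary.PropositionalEquality using (_≡_; refl; sym; trans; cong; cong₂; subst; subst₂; module ≡-Reasoning)

private
  variable
    a b k l m n : ℕ

∣p++q∣≡∣p∣+∣q∣ : (p : Subset m) (q : Subset n) → ∣ p ++ q ∣ ≡ ∣ p ∣ + ∣ q ∣
∣p++q∣≡∣p∣+∣q∣ []           q = refl
∣p++q∣≡∣p∣+∣q∣ (true  ∷ p) q = cong suc (∣p++q∣≡∣p∣+∣q∣ p q)
∣p++q∣≡∣p∣+∣q∣ (false ∷ p) q = ∣p++q∣≡∣p∣+∣q∣ p q

∣⊥++p∣≡∣p∣ : (p : Subset n) → ∣ ⊥ {m} ++ p ∣ ≡ ∣ p ∣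
∣⊥++p∣≡∣p∣ {m = m} p = trans (∣p++q∣≡∣p∣+∣q∣ (⊥ {m}) p) (cong (_+ ∣ p ∣) (∣⊥∣≡0 m))

∣p++⊥∣≡∣p∣ : (p : Subset m) → ∣ p ++ ⊥ {n} ∣ ≡ ∣ p ∣
∣p++⊥∣≡∣p∣ {n = n} p = trans (∣p++q∣≡∣p∣+∣q∣ p ⊥) (trans (+-comm ∣ p ∣ _) (cong (_+ ∣ p ∣) (∣⊥∣≡0 n)))

p++q∩p′++q′ : (p p′ : Subset m) (q q′ : Subset n) → (p ++ q) ∩ (p′ ++ q′) ≡ (p ∩ p′) ++ (q ∩ q′)
p++q∩p′++q′ []      []        q q′ = refl
p++q∩p′++q′ (x ∷ p) (x′ ∷ p′) q q′ = cong (_ ∷_) (p++q∩p′++q′ p p′ q q′)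

Empty-⊥ : Empty (⊥ {n})
Empty-⊥ (_ , x∈⊥) = ∉⊥ x∈⊥

Empty-⊥∩ : (p : Subset n) → Empty (⊥ ∩ p)
Empty-⊥∩ p = subst Empty (sym (∩-zeroˡ p)) Empty-⊥

Empty-∩⊥ : (p : Subset n) → Empty (p ∩ ⊥)
Empty-∩⊥ p = subst Empty (sym (∩-zeroʳ p)) Empty-⊥

Nonempty-outside∷ : (p : Subset n) → Nonempty (false ∷ p) ⇔ Nonempty p
Nonempty-outside∷ p = mk⇔ (λ { (fsuc x , there x∈p) → x , x∈p }) (λ (x , x∈p) → fsuc x , there x∈p)

Nonempty-++ : (p : Subset m) (q : Subset n) → Nonempty (p ++ q) ⇔ (Nonempty p ⊎ Nonempty q)
Nonempty-++ p q = mk⇔ (to p) [ fromˡ p , fromʳ p ]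
  where
  to : ∀ {m} (p : Subset m) → Nonempty (p ++ q) → Nonempty p ⊎ Nonempty q
  to []      ne                    = inj₂ ne
  to (_ ∷ p) (fzero  , here)       = inj₁ (fzero , here)
  to (_ ∷ p) (fsuc x , there x∈pq) with to p (x , x∈pq)
  ... | inj₁ (y , y∈p) = inj₁ (fsuc y , there y∈p)
  ... | inj₂ ne        = inj₂ ne

  fromˡ : ∀ {m} (p : Subset m) → Nonempty p → Nonempty (p ++ q)
  fromˡ (_ ∷ p) (fzero  , here)      = fzero , here
  fromˡ (_ ∷ p) (fsuc x , there x∈p) with fromˡ p (x , x∈p)
  ... | y , y∈pq = fsuc y , there y∈pq

  fromʳ : ∀ {m} (p : Subset m) → Nonempty q → Nonempty (p ++ q)
  fromʳ []      ne = ne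
  fromʳ (_ ∷ p) ne with fromʳ p ne
  ... | y , y∈pq = fsuc y , there y∈pq

Nonempty-++∩++ : (p p′ : Subset m) (q q′ : Subset n) →
                 Nonempty ((p ++ q) ∩ (p′ ++ q′)) ⇔ (Nonempty (p ∩ p′) ⊎ Nonempty (q ∩ q′))
Nonempty-++∩++ p p′ q q′ =
  subst (λ r → Nonempty r ⇔ (Nonempty (p ∩ p′) ⊎ Nonempty (q ∩ q′)))
        (sym (p++q∩p′++q′ p p′ q q′)) (Nonempty-++ (p ∩ p′) (q ∩ q′))

Nonempty-++∩++ʳ : (p p′ : Subset m) (q q′ : Subset n) → Empty (p ∩ p′) →
                  Nonempty ((p ++ q) ∩ (p′ ++ q′)) ⇔ Nonempty (q ∩ q′)
Nonempty-++∩++ʳ p p′ q q′ empty =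
  mk⇔ [ ⊥-elim ∘ empty , id ] (inj₂ {A = Nonempty (p ∩ p′)}) ⇔-∘ Nonempty-++∩++ p p′ q q′

Nonempty-++∩++ˡ : (p p′ : Subset m) (q q′ : Subset n) → Empty (q ∩ q′) →
                  Nonempty ((p ++ q) ∩ (p′ ++ q′)) ⇔ Nonempty (p ∩ p′)
Nonempty-++∩++ˡ p p′ q q′ empty =
  mk⇔ [ id , ⊥-elim ∘ empty ] (inj₁ {B = Nonempty (q ∩ q′)}) ⇔-∘ Nonempty-++∩++ p p′ q q′

Empty-++∩++ : (p p′ : Subset m) (q q′ : Subset n) → Empty (p ∩ p′) → Empty (q ∩ q′) →
              Empty ((p ++ q) ∩ (p′ ++ q′))
Empty-++∩++ p p′ q q′ emptyˡ emptyʳ ne =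
  [ emptyˡ , emptyʳ ] (Equivalence.to (Nonempty-++∩++ p p′ q q′) ne)

both : {P Q : Set} → P → Q → P ⇔ Q
both p q = mk⇔ (λ _ → q) (λ _ → p)

neither : {P Q : Set} → ¬ P → ¬ Q → P ⇔ Q
neither ¬p ¬q = mk⇔ (⊥-elim ∘ ¬p) (⊥-elim ∘ ¬q)

toℕ-↑ˡ<toℕ-↑ʳ : (i : Fin m) (j : Fin n) → toℕ (i ↑ˡ n) < toℕ (m ↑ʳ j)
toℕ-↑ˡ<toℕ-↑ʳ {m} {n} i j
  rewrite toℕ-↑ˡ i n | toℕ-↑ʳ m j = ≤-trans (toℕ<n i) (m≤m+n m (toℕ j))

toℕ-↑ʳ-≤⇔ : (i j : Fin n) → (toℕ i ≤ toℕ j) ⇔ (toℕ (m ↑ʳ i) ≤ toℕ (m ↑ʳ j))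
toℕ-↑ʳ-≤⇔ {m = m} i j
  rewrite toℕ-↑ʳ m i | toℕ-↑ʳ m j = mk⇔ (+-monoʳ-≤ m) (+-cancelˡ-≤ m _ _)

IsSystem-splitAt : ∀ m n (A B : Fin m ⊎ Fin n → Subset k) →
                   (∀ s → ∣ A s ∣ ≡ a) → (∀ t → ∣ B t ∣ ≡ b) →
                   (∀ s t → Nonempty (A s ∩ B t) ⇔ (toℕ (join m n t) ≤ toℕ (join m n s))) →
                   IsSystem a b (m + n) k (A ∘ splitAt m) (B ∘ splitAt m)
IsSystem-splitAt m n A B sizeA sizeB cross = record
  { sizeA = sizeA ∘ splitAt m
  ; sizeB = sizeB ∘ splitAt m
  ; cross = λ i j → subst₂ (λ i′ j′ → Nonempty (A (splitAt m i) ∩ B (splitAt m j)) ⇔ (toℕ j′ ≤ toℕ i′))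
                           (join-splitAt m n i) (join-splitAt m n j)
                           (cross (splitAt m i) (splitAt m j))
  }

AchievesAnchored : ℕ → ℕ → ℕ → Set
AchievesAnchored a b m =
  Σ ℕ λ l → Σ (Fin m → Subset (suc l)) λ A → Σ (Fin m → Subset (suc l)) λ B →
    IsSystem a b m (suc l) A B × (∀ i → fzero ∈ A i)

anchor : AchievesAtLeast a (suc b) m → AchievesAnchored (suc a) (suc b) (suc m)
anchor {a} {b} {m} (k , A , B , sys) = (a + b) + k , A⁺ , B⁺ , sys⁺ , fzero∈A⁺
  where
  module T = IsSystem sys
  P Q : Subset (a + b)
  P = ⊤ {a} ++ ⊥ {b}
  Q = ⊥ {a} ++ ⊤ {b}

  A⁺ B⁺ : Fin (suc m) → Subset (suc ((a + b) + k))
  A⁺ fzero    = true ∷ (P ++ ⊥)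
  A⁺ (fsuc i) = true ∷ (⊥ ++ A i)
  B⁺ fzero    = true ∷ (Q ++ ⊥)
  B⁺ (fsuc j) = false ∷ (⊥ ++ B j)

  fzero∈A⁺ : ∀ i → fzero ∈ A⁺ i
  fzero∈A⁺ fzero    = here
  fzero∈A⁺ (fsuc i) = here

  sizeA⁺ : ∀ i → ∣ A⁺ i ∣ ≡ suc a
  sizeA⁺ fzero    = cong suc (trans (∣p++⊥∣≡∣p∣ {n = k} P) (trans (∣p++⊥∣≡∣p∣ {n = b} (⊤ {a})) (∣⊤∣≡n a)))
  sizeA⁺ (fsuc i) = cong suc (trans (∣⊥++p∣≡∣p∣ {m = a + b} (A i)) (T.sizeA i))

  sizeB⁺ : ∀ j → ∣ B⁺ j ∣ ≡ suc b
  sizeB⁺ fzero    = cong suc (trans (∣p++⊥∣≡∣p∣ {n = k} Q) (trans (∣⊥++p∣≡∣p∣ {m = a} ⊤) (∣⊤∣≡n b)))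
  sizeB⁺ (fsuc j) = trans (∣⊥++p∣≡∣p∣ {m = a + b} (B j)) (T.sizeB j)

  cross⁺ : ∀ i j → Nonempty (A⁺ i ∩ B⁺ j) ⇔ (toℕ j ≤ toℕ i)
  cross⁺ i        fzero    = both (fzero , x∈p∩q⁺ (fzero∈A⁺ i , here)) z≤n
  cross⁺ fzero    (fsuc j) =
    neither (Empty-++∩++ P ⊥ ⊥ (B j) (Empty-∩⊥ P) (Empty-⊥∩ (B j))
               ∘ Equivalence.to (Nonempty-outside∷ _))
            λ ()
  cross⁺ (fsuc i) (fsuc j) = begin
    Nonempty (false ∷ ((⊥ ++ A i) ∩ (⊥ ++ B j))) ∼⟨ Nonempty-outside∷ _ ⟩
    Nonempty ((⊥ ++ A i) ∩ (⊥ ++ B j))           ∼⟨ Nonempty-++∩++ʳ ⊥ ⊥ (A i) (B j) (Empty-⊥∩ ⊥) ⟩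
    Nonempty (A i ∩ B j)                         ∼⟨ T.cross i j ⟩
    toℕ j ≤ toℕ i                                ∼⟨ mk⇔ s≤s s≤s⁻¹ ⟩
    suc (toℕ j) ≤ suc (toℕ i)                    ∎
    where open EquationalReasoning

  sys⁺ : IsSystem (suc a) (suc b) (suc m) (suc ((a + b) + k)) A⁺ B⁺
  sys⁺ = record { sizeA = sizeA⁺ ; sizeB = sizeB⁺ ; cross = cross⁺ }

prepend : AchievesAtLeast a b m → AchievesAnchored a (suc b) n → AchievesAtLeast a (suc b) (m + n)
prepend {a} {b} {m} {n} (k , C , D , sysS) (l , A , B , sysU , fzero∈A) =
  suc l + k , A′ ∘ splitAt m , B′ ∘ splitAt m , IsSystem-splitAt m n A′ B′ sizeA′ sizeB′ cross′
  where
  module S = IsSystem sysS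
  module U = IsSystem sysU
  A′ B′ : Fin m ⊎ Fin n → Subset (suc l + k)
  A′ (inj₁ i) = ⊥ ++ C i
  A′ (inj₂ i) = A i ++ ⊥
  B′ (inj₁ j) = ⁅ fzero ⁆ ++ D j
  B′ (inj₂ j) = B j ++ ⊥

  sizeA′ : ∀ s → ∣ A′ s ∣ ≡ a
  sizeA′ (inj₁ i) = trans (∣⊥++p∣≡∣p∣ {m = suc l} (C i)) (S.sizeA i)
  sizeA′ (inj₂ i) = trans (∣p++⊥∣≡∣p∣ {n = k} (A i)) (U.sizeA i)

  sizeB′ : ∀ t → ∣ B′ t ∣ ≡ suc b
  sizeB′ (inj₁ j) = cong suc (trans (∣⊥++p∣≡∣p∣ {m = l} (D j)) (S.sizeB j))
  sizeB′ (inj₂ j) = trans (∣p++⊥∣≡∣p∣ {n = k} (B j)) (U.sizeB j)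

  cross′ : ∀ s t → Nonempty (A′ s ∩ B′ t) ⇔ (toℕ (join m n t) ≤ toℕ (join m n s))
  cross′ (inj₁ i) (inj₁ j) rewrite toℕ-↑ˡ i n | toℕ-↑ˡ j n =
    S.cross i j ⇔-∘ Nonempty-++∩++ʳ ⊥ ⁅ fzero ⁆ (C i) (D j) (Empty-⊥∩ ⁅ fzero ⁆)
  cross′ (inj₁ i) (inj₂ j) =
    neither (Empty-++∩++ ⊥ (B j) (C i) ⊥ (Empty-⊥∩ (B j)) (Empty-∩⊥ (C i)))
            (<⇒≱ (toℕ-↑ˡ<toℕ-↑ʳ i j))
  cross′ (inj₂ i) (inj₁ j) =
    both (Equivalence.from (Nonempty-++∩++ (A i) ⁅ fzero ⁆ ⊥ (D j))
                           (inj₁ (fzero , x∈p∩q⁺ (fzero∈A i , x∈⁅x⁆ fzero))))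
         (<⇒≤ (toℕ-↑ˡ<toℕ-↑ʳ j i))
  cross′ (inj₂ i) (inj₂ j) =
    toℕ-↑ʳ-≤⇔ j i ⇔-∘ (U.cross i j ⇔-∘ Nonempty-++∩++ˡ (A i) (B j) ⊥ ⊥ (Empty-⊥∩ ⊥))

achieves-zero : AchievesAtLeast a b 0
achieves-zero = 0 , (λ ()) , (λ ()) , record { sizeA = λ () ; sizeB = λ () ; cross = λ () }

achieves-Pascal : AchievesAtLeast (suc a) b m → AchievesAtLeast a (suc b) n →
                  AchievesAtLeast (suc a) (suc b) (m + suc n)
achieves-Pascal S T = prepend S (anchor T)

achieves-binomial : ∀ a b → ∃[ m ] suc m ≡ (a + b) C a × AchievesAtLeast a b m
achieves-binomial zero    b       = 0 , refl , achieves-zero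
achieves-binomial (suc a) zero    =
  0 , sym (trans (cong (_C suc a) (+-identityʳ (suc a))) (nCn≡1 (suc a))) , achieves-zero
achieves-binomial (suc a) (suc b) with achieves-binomial (suc a) b | achieves-binomial a (suc b)
... | m , 1+m≡C , S | n , 1+n≡C , T = m + suc n , Pascal , achieves-Pascal S T
  where
  open ≡-Reasoning
  Pascal : suc (m + suc n) ≡ (suc a + suc b) C suc a
  Pascal = begin
    suc m + suc n                                ≡⟨ cong₂ _+_ 1+m≡C 1+n≡C ⟩
    (suc a + b) C suc a + (a + suc b) C a        ≡⟨ cong (λ c → c C suc a + (a + suc b) C a) (sym (+-suc a b)) ⟩
    (a + suc b) C suc a + (a + suc b) C a        ≡⟨ +-comm ((a + suc b) C suc a) _ ⟩
    (a + suc b) C a + (a + suc b) C suc a        ≡⟨ nCk+nC[k+1]≡[n+1]C[k+1] (a + suc b) a ⟩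
    suc (a + suc b) C suc a                      ∎

lemma3 : (a b : ℕ) → 1 ≤ a → 1 ≤ b → AchievesAtLeast a b (((a + b) C a) ∸ 1)
lemma3 a b _ _ with achieves-binomial a b
... | m , 1+m≡C , S = subst (AchievesAtLeast a b) (cong (_∸ 1) 1+m≡C) S
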